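{- For any prime power $q$ and any $\epsilon>0$ there exists $\delta>0$ such that, for all sufficiently large $n$, we have $m_{(1-\delta)(q-1)n}(q,n)\ge q^n-q^{\epsilon n}$.
   Context: $\mathcal{M}(q,n)=\{x_1^{a_1}\cdots x_n^{a_n} : 0\le a_i\le q-1\}$ is the set of $q^n$ monomials in $n$ variables with each individual degree at most $q-1$. For a real number $d$, $\mathcal{M}_d(q,n)$ is the set of monomials in $\mathcal{M}(q,n)$ of total degree at most $d$, and $m_d(q,n)=|\mathcal{M}_d(q,n)|$. -}

module Defs where

open import Data.Nat using (ℕ; zero; suc; _^_; _≤_)
open import Data.Nat.Primality using (Prime)
open import Data.Integer using (+_; ∣_∣)
open import Data.Rational using (ℚ; _/_)
import Data.Rational as ℚ
open import Data.Rational.Properties using (_≤?_)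
open import Data.List using (List; []; _∷_; [_]; map; concatMap; upTo; length; filter)
open import Data.Vec using (Vec; sum)
import Data.Vec as Vec
open import Data.Product using (Σ; _×_)

toℚ : ℕ → ℚ
toℚ n = + n / 1

IsPrimePower : ℕ → Set
IsPrimePower q = Σ ℕ λ p → Σ ℕ λ k → Prime p × (1 ≤ k) × (q ≡' p ^ k)
  where
  open import Relation.Binary.PropositionalEquality using () renaming (_≡_ to _≡'_)

-- M(q,n): all exponent vectors (a_1,…,a_n) with 0 ≤ a_i ≤ q-1;
-- the vector a represents the monomial x_1^{a_1}⋯x_n^{a_n}
monomials : (q n : ℕ) → List (Vec ℕ n)
monomials q zero    = [ Vec.[] ]
monomials q (suc n) = concatMap (λ a → map (a Vec.∷_) (monomials q n)) (upTo q)

totalDegree : {n : ℕ} → Vec ℕ n → ℕ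
totalDegree = sum

m : ℚ → (q n : ℕ) → ℕ
m d q n = length (filter (λ a → toℚ (totalDegree a) ≤? d) (monomials q n))

-- For a rational r ≥ 0:  x ≤ q^r  (real exponentiation) holds iff
-- x^(denominator r) ≤ q^(numerator r).
_≤_^ℚ_ : ℕ → ℕ → ℚ → Set
x ≤ q ^ℚ r = x ^ ℚ.denominatorℕ r ≤ q ^ ∣ ℚ.numerator r ∣

module Submission where

-- Write q = c + 1, so c·n is the largest possible degree in M(q,n).
-- A monomial missing from M_{(1-δ)cn}(q,n) has degree within δ·c·n of the
-- maximum; with δ = 1/(C·c) its deficiency is at most E = ⌊n/C⌋.  Such
-- "nearly full" monomials are few by a Chernoff (exponential Markov)
-- argument: weighting each monomial by L^deg, with L = w + 1, gives
--   #nearly-full · L^(cn) ≤ L^E · (1 + L + ⋯ + L^c)^n ≤ L^E · L^(cn) · (L/w)^n.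
-- Choosing w = 2h and C = h·L makes both L^E and (L/w)^n at most 2^(n/h),
-- so the count is at most 4^(n/h); for h = 2(b+1) this is 2^(n/(b+1)),
-- which is ≤ q^(εn) when ε = (a+1)/(b+1).

open import Defs
open import Data.Nat using (ℕ; zero; suc; pred; _+_; _≤_; _<_; _∸_; _^_; z≤n; s≤s; _≤?_; NonZero; >-nonZero; >-nonZero⁻¹; nonTrivial⇒n>1; _/_) renaming (_*_ to _*ℕ_)
open import Data.Nat.Properties
open import Data.Nat.DivMod using (m*n/n≡m; m/n*n≤m; /-monoˡ-≤)
open import Data.Nat.Coprimality using (Coprime; 1-coprimeTo)
import Data.Nat.Coprimality as Coprimality
open import Data.Nat.ListAction using (sum)
open import Data.Nat.ListAction.Properties using (sum-++)
open import Data.Nat.Primality using (prime⇒nonTrivial)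
open import Data.Nat.Tactic.RingSolver using (solve-∀)
open import Data.Integer using (+[1+_]; +0; -[1+_])
import Data.Integer as ℤ
import Data.Integer.Properties as ℤ
open import Data.Rational using (ℚ; Positive; mkℚ; 1ℚ; _-_; _*_; toℚᵘ)
import Data.Rational as ℚ
import Data.Rational.Properties as ℚ
open import Data.Rational.Unnormalised using (ℚᵘ; mkℚᵘ; _≃_; *<*; *≡*)
import Data.Rational.Unnormalised as ℚᵘ
import Data.Rational.Unnormalised.Properties as ℚᵘ
open import Data.List using (List; []; _∷_; [_]; _++_; map; concatMap; upTo; length; filter)
open import Data.List.Properties using (length-++; length-map; length-upTo; map-++; map-∘; upTo-∷ʳ)
open import Data.Vec using (Vec)
import Data.Vec as Vec
open import Data.Product using (Σ; _×_; _,_)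
open import Data.Empty using (⊥-elim)
open import Relation.Nullary using (¬_; yes; no; contradiction)
open import Relation.Unary using (Decidable)
open import Relation.Binary.PropositionalEquality using (_≡_; refl; sym; trans; cong; cong₂; subst; subst₂; module ≡-Reasoning)

^-distrib-* : ∀ x y k → (x *ℕ y) ^ k ≡ x ^ k *ℕ y ^ k
^-distrib-* x y zero    = refl
^-distrib-* x y (suc k) = trans (cong ((x *ℕ y) *ℕ_) (^-distrib-* x y k)) (interchange x y (x ^ k) (y ^ k))
  where
  interchange : ∀ a b c d → (a *ℕ b) *ℕ (c *ℕ d) ≡ (a *ℕ c) *ℕ (b *ℕ d)
  interchange = solve-∀

^-swap : ∀ x m n → (x ^ m) ^ n ≡ (x ^ n) ^ m
^-swap x m n = trans (^-*-assoc x m n) (trans (cong (x ^_) (*-comm m n)) (sym (^-*-assoc x n m)))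

^-cancelˡ-≤ : ∀ k .{{_ : NonZero k}} {u v} → u ^ k ≤ v ^ k → u ≤ v
^-cancelˡ-≤ k {u} {v} u^k≤v^k with u ≤? v
... | yes u≤v = u≤v
... | no  u≰v = ⊥-elim (<⇒≱ (^-monoˡ-< k (≰⇒> u≰v)) u^k≤v^k)

module _ {A : Set} where

  sum-map-scale : ∀ (f g : A → ℕ) k → (∀ x → g x ≡ k *ℕ f x) →
                  ∀ xs → sum (map g xs) ≡ k *ℕ sum (map f xs)
  sum-map-scale f g k g≡kf [] = sym (*-zeroʳ k)
  sum-map-scale f g k g≡kf (x ∷ xs) = begin
    g x + sum (map g xs)              ≡⟨ cong₂ _+_ (g≡kf x) (sum-map-scale f g k g≡kf xs) ⟩
    k *ℕ f x + k *ℕ sum (map f xs)    ≡⟨ *-distribˡ-+ k (f x) _ ⟨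
    k *ℕ (f x + sum (map f xs))       ∎
    where open ≡-Reasoning

  count-by-weight : ∀ {P : A → Set} (P? : Decidable P) (f : A → ℕ) K →
                    (∀ {x} → P x → K ≤ f x) →
                    ∀ xs → length (filter P? xs) *ℕ K ≤ sum (map f xs)
  count-by-weight P? f K heavy [] = z≤n
  count-by-weight P? f K heavy (x ∷ xs) with P? x
  ... | yes px = +-mono-≤ (heavy px) (count-by-weight P? f K heavy xs)
  ... | no _   = ≤-trans (count-by-weight P? f K heavy xs) (m≤n+m _ (f x))

  count-cover : ∀ {P Q : A → Set} (P? : Decidable P) (Q? : Decidable Q) →
                (∀ x → ¬ P x → Q x) →
                ∀ xs → length xs ≤ length (filter P? xs) + length (filter Q? xs)
  count-cover P? Q? ¬P⇒Q [] = z≤n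
  count-cover P? Q? ¬P⇒Q (x ∷ xs) with P? x | Q? x | count-cover P? Q? ¬P⇒Q xs
  ... | yes _ | yes _ | ih = s≤s (≤-trans ih (+-monoʳ-≤ _ (n≤1+n _)))
  ... | yes _ | no _  | ih = s≤s ih
  ... | no _  | yes _ | ih = ≤-trans (s≤s ih) (≤-reflexive (sym (+-suc _ _)))
  ... | no ¬p | no ¬q | _  = ⊥-elim (¬q (¬P⇒Q x ¬p))

extend : ∀ {n} → List ℕ → List (Vec ℕ n) → List (Vec ℕ (suc n))
extend l M = concatMap (λ a → map (a Vec.∷_) M) l

length-extend : ∀ {n} (l : List ℕ) (M : List (Vec ℕ n)) →
                length (extend l M) ≡ length l *ℕ length M
length-extend [] M = refl
length-extend (a ∷ l) M = begin
  length (map (a Vec.∷_) M ++ extend l M)         ≡⟨ length-++ (map (a Vec.∷_) M) ⟩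
  length (map (a Vec.∷_) M) + length (extend l M) ≡⟨ cong₂ _+_ (length-map (a Vec.∷_) M) (length-extend l M) ⟩
  length M + length l *ℕ length M                 ∎
  where open ≡-Reasoning

monomials-count : ∀ q n → length (monomials q n) ≡ q ^ n
monomials-count q zero    = refl
monomials-count q (suc n) = begin
  length (extend (upTo q) (monomials q n))       ≡⟨ length-extend (upTo q) (monomials q n) ⟩
  length (upTo q) *ℕ length (monomials q n)      ≡⟨ cong₂ _*ℕ_ (length-upTo q) (monomials-count q n) ⟩
  q *ℕ q ^ n                                     ∎
  where open ≡-Reasoning

module _ (L : ℕ) where

  weight : ∀ {n} → Vec ℕ n → ℕ
  weight v = L ^ totalDegree v

  -- Prepending a ∈ l multiplies the weight by L^a.
  weight-extend : ∀ {n} (l : List ℕ) (M : List (Vec ℕ n)) →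
                  sum (map weight (extend l M)) ≡ sum (map (L ^_) l) *ℕ sum (map weight M)
  weight-extend [] M = refl
  weight-extend (a ∷ l) M = begin
    sum (map weight (map (a Vec.∷_) M ++ extend l M))
      ≡⟨ cong sum (map-++ weight (map (a Vec.∷_) M) (extend l M)) ⟩
    sum (map weight (map (a Vec.∷_) M) ++ map weight (extend l M))
      ≡⟨ sum-++ (map weight (map (a Vec.∷_) M)) _ ⟩
    sum (map weight (map (a Vec.∷_) M)) + sum (map weight (extend l M))
      ≡⟨ cong₂ _+_ first-row (weight-extend l M) ⟩
    L ^ a *ℕ W + sum (map (L ^_) l) *ℕ W
      ≡⟨ *-distribʳ-+ W (L ^ a) _ ⟨
    (L ^ a + sum (map (L ^_) l)) *ℕ W ∎
    where
    open ≡-Reasoning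
    W : ℕ
    W = sum (map weight M)
    first-row : sum (map weight (map (a Vec.∷_) M)) ≡ L ^ a *ℕ W
    first-row = trans (cong sum (sym (map-∘ M)))
      (sum-map-scale weight (λ v → weight (a Vec.∷ v)) (L ^ a) (λ v → ^-distribˡ-+-* L a _) M)

  weight-monomials : ∀ q n → sum (map weight (monomials q n)) ≡ sum (map (L ^_) (upTo q)) ^ n
  weight-monomials q zero    = refl
  weight-monomials q (suc n) =
    trans (weight-extend (upTo q) (monomials q n)) (cong (sum (map (L ^_) (upTo q)) *ℕ_) (weight-monomials q n))

geometric : ∀ w q → w *ℕ sum (map (suc w ^_) (upTo q)) + 1 ≡ suc w ^ q
geometric w zero    = cong (_+ 1) (*-zeroʳ w)
geometric w (suc q) = begin
  w *ℕ sum (map (L ^_) (upTo (suc q))) + 1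
    ≡⟨ cong (λ l → w *ℕ sum (map (L ^_) l) + 1) (sym (upTo-∷ʳ q)) ⟩
  w *ℕ sum (map (L ^_) (upTo q ++ [ q ])) + 1
    ≡⟨ cong (λ l → w *ℕ sum l + 1) (map-++ (L ^_) (upTo q) [ q ]) ⟩
  w *ℕ sum (map (L ^_) (upTo q) ++ [ L ^ q ]) + 1
    ≡⟨ cong (λ s → w *ℕ s + 1) (sum-++ (map (L ^_) (upTo q)) [ L ^ q ]) ⟩
  w *ℕ (S + (L ^ q + 0)) + 1
    ≡⟨ rearrange w S (L ^ q) ⟩
  (w *ℕ S + 1) + w *ℕ L ^ q
    ≡⟨ cong (_+ w *ℕ L ^ q) (geometric w q) ⟩
  L ^ q + w *ℕ L ^ q ∎
  where
  open ≡-Reasoning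
  L S : ℕ
  L = suc w
  S = sum (map (L ^_) (upTo q))
  rearrange : ∀ w S P → w *ℕ (S + (P + 0)) + 1 ≡ (w *ℕ S + 1) + w *ℕ P
  rearrange = solve-∀

nearlyFull : (c n E : ℕ) → ℕ
nearlyFull c n E = length (filter (λ v → c *ℕ n ≤? E + totalDegree v) (monomials (suc c) n))

-- By Markov, nearlyFull · L^(cn) ≤ Σ_v L^(E + deg v) = L^E (1 + L + ⋯ + L^c)^n,
-- and w (1 + L + ⋯ + L^c) ≤ L^(c+1) by the geometric series.
tail-bound : ∀ c n E w → nearlyFull c n E *ℕ w ^ n ≤ suc w ^ (E + n)
tail-bound c n E w = *-cancelˡ-≤ (L ^ (c *ℕ n)) {{m^n≢0 L (c *ℕ n)}} (begin
  L ^ (c *ℕ n) *ℕ (X *ℕ w ^ n)         ≡⟨ swap (L ^ (c *ℕ n)) X (w ^ n) ⟩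
  (X *ℕ L ^ (c *ℕ n)) *ℕ w ^ n         ≤⟨ *-monoˡ-≤ (w ^ n) markov ⟩
  (L ^ E *ℕ S ^ n) *ℕ w ^ n            ≡⟨ regroup (L ^ E) (S ^ n) (w ^ n) ⟩
  L ^ E *ℕ (w ^ n *ℕ S ^ n)            ≡⟨ cong (L ^ E *ℕ_) (^-distrib-* w S n) ⟨
  L ^ E *ℕ (w *ℕ S) ^ n                ≤⟨ *-monoʳ-≤ (L ^ E) (^-monoˡ-≤ n wS≤L^q) ⟩
  L ^ E *ℕ (L ^ suc c) ^ n             ≡⟨ exponents ⟩
  L ^ (c *ℕ n) *ℕ L ^ (E + n)          ∎)
  where
  open ≤-Reasoning
  L S X : ℕ
  L = suc w
  S = sum (map (L ^_) (upTo (suc c)))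
  X = nearlyFull c n E
  markov : X *ℕ L ^ (c *ℕ n) ≤ L ^ E *ℕ S ^ n
  markov = ≤-trans
    (count-by-weight (λ v → c *ℕ n ≤? E + totalDegree v) (λ v → L ^ (E + totalDegree v)) _
       (^-monoʳ-≤ L) (monomials (suc c) n))
    (≤-reflexive (trans (sum-map-scale (weight L) _ (L ^ E) (λ v → ^-distribˡ-+-* L E _) (monomials (suc c) n))
                        (cong (L ^ E *ℕ_) (weight-monomials L (suc c) n))))
  wS≤L^q : w *ℕ S ≤ L ^ suc c
  wS≤L^q = ≤-trans (m≤m+n (w *ℕ S) 1) (≤-reflexive (geometric w (suc c)))
  swap : ∀ a b c → a *ℕ (b *ℕ c) ≡ (b *ℕ a) *ℕ c
  swap = solve-∀
  regroup : ∀ a b c → (a *ℕ b) *ℕ c ≡ a *ℕ (c *ℕ b)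
  regroup = solve-∀
  exponent-sum : ∀ c n E → E + (n + c *ℕ n) ≡ c *ℕ n + (E + n)
  exponent-sum = solve-∀
  exponents : L ^ E *ℕ (L ^ suc c) ^ n ≡ L ^ (c *ℕ n) *ℕ L ^ (E + n)
  exponents = begin-equality
    L ^ E *ℕ (L ^ suc c) ^ n         ≡⟨ cong (L ^ E *ℕ_) (^-*-assoc L (suc c) n) ⟩
    L ^ E *ℕ L ^ (suc c *ℕ n)        ≡⟨ ^-distribˡ-+-* L E _ ⟨
    L ^ (E + (n + c *ℕ n))           ≡⟨ cong (L ^_) (exponent-sum c n E) ⟩
    L ^ (c *ℕ n + (E + n))           ≡⟨ ^-distribˡ-+-* L (c *ℕ n) (E + n) ⟩
    L ^ (c *ℕ n) *ℕ L ^ (E + n)      ∎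

-- A Bernoulli-type estimate: (1 + 1/w)^k ≤ w/t for w = k + t, in the form
-- (w + 1)^k · t ≤ w^(k+1).
bernoulli : ∀ k t → suc (k + t) ^ k *ℕ t ≤ (k + t) ^ suc k
bernoulli zero    t = ≤-reflexive (trans (+-identityʳ t) (sym (*-identityʳ t)))
bernoulli (suc k) t = begin
  (suc w *ℕ suc w ^ k) *ℕ t   ≡⟨ reassoc (suc w) (suc w ^ k) t ⟩
  suc w ^ k *ℕ (suc w *ℕ t)   ≤⟨ *-monoʳ-≤ (suc w ^ k) key ⟩
  suc w ^ k *ℕ (suc t *ℕ w)   ≡⟨ *-assoc (suc w ^ k) (suc t) w ⟨
  (suc w ^ k *ℕ suc t) *ℕ w   ≤⟨ *-monoˡ-≤ w ih ⟩
  w ^ suc k *ℕ w              ≡⟨ *-comm (w ^ suc k) w ⟩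
  w *ℕ w ^ suc k              ∎
  where
  open ≤-Reasoning
  w : ℕ
  w = suc (k + t)
  reassoc : ∀ x y z → (x *ℕ y) *ℕ z ≡ y *ℕ (x *ℕ z)
  reassoc = solve-∀
  ih : suc w ^ k *ℕ suc t ≤ w ^ suc k
  ih = subst (λ x → suc x ^ k *ℕ suc t ≤ x ^ suc k) (+-suc k t) (bernoulli k (suc t))
  -- (w + 1)·t ≤ (t + 1)·w since t ≤ w
  key : suc w *ℕ t ≤ suc t *ℕ w
  key = begin
    t + w *ℕ t   ≤⟨ +-monoˡ-≤ (w *ℕ t) (m≤n⇒m≤1+n (m≤n+m t k)) ⟩
    w + w *ℕ t   ≡⟨ cong (w +_) (*-comm w t) ⟩
    w + t *ℕ w   ∎

n<2^n : ∀ n → n < 2 ^ n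
n<2^n zero    = s≤s z≤n
n<2^n (suc n) = begin-strict
  suc n          ≤⟨ n<2^n n ⟩
  2 ^ n          <⟨ m<m+n (2 ^ n) (m^n>0 2 n) ⟩
  2 ^ n + 2 ^ n  ≡⟨ cong (2 ^ n +_) (+-identityʳ (2 ^ n)) ⟨
  2 ^ suc n      ∎
  where open ≤-Reasoning

module Parameters (h : ℕ) .{{h≢0 : NonZero h}} where

  w L C : ℕ
  w = h + h
  L = suc w
  C = h *ℕ L

  instance
    w≢0 : NonZero w
    w≢0 = >-nonZero (≤-trans (>-nonZero⁻¹ h) (m≤m+n h h))

  L^h≤2w^h : L ^ h ≤ 2 *ℕ w ^ h
  L^h≤2w^h = *-cancelʳ-≤ (L ^ h) (2 *ℕ w ^ h) h
    (≤-trans (bernoulli h h) (≤-reflexive (double h (w ^ h))))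
    where
    double : ∀ x y → (x + x) *ℕ y ≡ (2 *ℕ y) *ℕ x
    double = solve-∀

  -- If X·w^n ≤ L^(E+n) with E·C ≤ n, then X ≤ 4^(n/h): the factor
  -- L^E ≤ 2^(L·E) contributes at most 2^(n/h), and (L/w)^n ≤ 2^(n/h).
  power-bound : ∀ n E X → E *ℕ C ≤ n → X *ℕ w ^ n ≤ L ^ (E + n) → X ^ h ≤ 4 ^ n
  power-bound n E X EC≤n Xw^n≤ = *-cancelʳ-≤ (X ^ h) (4 ^ n) ((w ^ n) ^ h) {{m^n≢0 (w ^ n) h {{m^n≢0 w n}}}} (begin
    X ^ h *ℕ (w ^ n) ^ h                 ≡⟨ ^-distrib-* X (w ^ n) h ⟨
    (X *ℕ w ^ n) ^ h                     ≤⟨ ^-monoˡ-≤ h Xw^n≤ ⟩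
    (L ^ (E + n)) ^ h                    ≡⟨ ^-*-assoc L (E + n) h ⟩
    L ^ ((E + n) *ℕ h)                   ≡⟨ cong (L ^_) (*-distribʳ-+ h E n) ⟩
    L ^ (E *ℕ h + n *ℕ h)                ≡⟨ ^-distribˡ-+-* L (E *ℕ h) (n *ℕ h) ⟩
    L ^ (E *ℕ h) *ℕ L ^ (n *ℕ h)         ≤⟨ *-mono-≤ excess-part main-part ⟩
    2 ^ n *ℕ (2 ^ n *ℕ (w ^ n) ^ h)      ≡⟨ *-assoc (2 ^ n) (2 ^ n) _ ⟨
    (2 ^ n *ℕ 2 ^ n) *ℕ (w ^ n) ^ h      ≡⟨ cong (_*ℕ (w ^ n) ^ h) (^-distrib-* 2 2 n) ⟨
    4 ^ n *ℕ (w ^ n) ^ h                 ∎)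
    where
    open ≤-Reasoning
    excess-part : L ^ (E *ℕ h) ≤ 2 ^ n
    excess-part = begin
      L ^ (E *ℕ h)         ≤⟨ ^-monoˡ-≤ (E *ℕ h) (<⇒≤ (n<2^n L)) ⟩
      (2 ^ L) ^ (E *ℕ h)   ≡⟨ ^-*-assoc 2 L (E *ℕ h) ⟩
      2 ^ (L *ℕ (E *ℕ h))  ≡⟨ cong (2 ^_) (rotate L E h) ⟩
      2 ^ (E *ℕ C)         ≤⟨ ^-monoʳ-≤ 2 EC≤n ⟩
      2 ^ n                ∎
      where
      rotate : ∀ a x c → a *ℕ (x *ℕ c) ≡ x *ℕ (c *ℕ a)
      rotate = solve-∀
    main-part : L ^ (n *ℕ h) ≤ 2 ^ n *ℕ (w ^ n) ^ h
    main-part = begin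
      L ^ (n *ℕ h)             ≡⟨ cong (L ^_) (*-comm n h) ⟩
      L ^ (h *ℕ n)             ≡⟨ ^-*-assoc L h n ⟨
      (L ^ h) ^ n              ≤⟨ ^-monoˡ-≤ n L^h≤2w^h ⟩
      (2 *ℕ w ^ h) ^ n         ≡⟨ ^-distrib-* 2 (w ^ h) n ⟩
      2 ^ n *ℕ (w ^ h) ^ n     ≡⟨ cong (2 ^ n *ℕ_) (^-swap w h n) ⟩
      2 ^ n *ℕ (w ^ n) ^ h     ∎

unitFraction : ℕ → ℚ
unitFraction r = mkℚ (ℤ.+ 1) r (1-coprimeTo (suc r))

toℚᵘ-toℚ : ∀ n → toℚᵘ (toℚ n) ≡ mkℚᵘ (ℤ.+ n) 0
toℚᵘ-toℚ n = cong toℚᵘ (ℚ.normalize-coprime (Coprimality.sym (1-coprimeTo n)))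

thresholdᵘ : ℕ → ℕ → ℚᵘ
thresholdᵘ r M = (mkℚᵘ (ℤ.+ 1) 0 ℚᵘ.+ mkℚᵘ -[1+ 0 ] r) ℚᵘ.* mkℚᵘ (ℤ.+ M) 0

threshold-toℚᵘ : ∀ r M → toℚᵘ ((1ℚ - unitFraction r) * toℚ M) ≃ thresholdᵘ r M
threshold-toℚᵘ r M = ℚᵘ.≃-trans (ℚ.toℚᵘ-homo-* (1ℚ - unitFraction r) (toℚ M))
  (ℚᵘ.*-cong (ℚᵘ.≃-trans (ℚ.toℚᵘ-homo-+ 1ℚ (ℚ.- unitFraction r))
                         (ℚᵘ.+-cong (ℚᵘ.≃-refl {mkℚᵘ (ℤ.+ 1) 0}) (ℚ.toℚᵘ-homo‿- (unitFraction r))))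
             (ℚᵘ.≃-reflexive (toℚᵘ-toℚ M)))

numerator-threshold : ∀ r M → ℚᵘ.↥ (thresholdᵘ r M) ≡ ℤ.+ (r *ℕ M)
numerator-threshold r M = trans (ℤ.+◃n≡+n _) (cong (λ a → ℤ.+ (a *ℕ M)) (+-identityʳ r))

denominator-threshold : ∀ r M → ℚᵘ.↧ (thresholdᵘ r M) ≡ ℤ.+ suc r
denominator-threshold r M = cong (λ a → ℤ.+ suc a) (trans (*-identityʳ _) (+-identityʳ r))

above-threshold : ∀ r s M → ¬ (toℚ s ℚ.≤ (1ℚ - unitFraction r) * toℚ M) → r *ℕ M < s *ℕ suc r
above-threshold r s M s≰t = cross-multiply (ℚᵘ.<-respˡ-≃ (threshold-toℚᵘ r M)
  (subst (toℚᵘ ((1ℚ - unitFraction r) * toℚ M) ℚᵘ.<_) (toℚᵘ-toℚ s) (ℚ.toℚᵘ-mono-< (ℚ.≰⇒> s≰t))))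
  where
  cross-multiply : thresholdᵘ r M ℚᵘ.< mkℚᵘ (ℤ.+ s) 0 → r *ℕ M < s *ℕ suc r
  cross-multiply (*<* rM<s[r+1]) = subst (_< s *ℕ suc r) (*-identityʳ (r *ℕ M)) (ℤ.drop‿+<+ (subst₂ ℤ._<_
    (trans (cong (ℤ._* ℤ.+ 1) (numerator-threshold r M)) (sym (ℤ.pos-* (r *ℕ M) 1)))
    (trans (cong (ℤ.+ s ℤ.*_) (denominator-threshold r M)) (sym (ℤ.pos-* s (suc r))))
    rM<s[r+1]))

deficiency-bound : ∀ r s M → ¬ (toℚ s ℚ.≤ (1ℚ - unitFraction r) * toℚ M) → suc r *ℕ (M ∸ s) ≤ M
deficiency-bound r s M s≰t = begin
  suc r *ℕ (M ∸ s)           ≡⟨ *-distribˡ-∸ (suc r) M s ⟩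
  suc r *ℕ M ∸ suc r *ℕ s    ≤⟨ m≤n+o⇒m∸n≤o (suc r *ℕ M) (suc r *ℕ s) bound ⟩
  M                          ∎
  where
  open ≤-Reasoning
  bound : suc r *ℕ M ≤ suc r *ℕ s + M
  bound = begin
    M + r *ℕ M           ≤⟨ +-monoʳ-≤ M (<⇒≤ (above-threshold r s M s≰t)) ⟩
    M + s *ℕ suc r       ≡⟨ +-comm M _ ⟩
    s *ℕ suc r + M       ≡⟨ cong (_+ M) (*-comm s (suc r)) ⟩
    suc r *ℕ s + M       ∎

small-deficiency : ∀ c C n s .{{_ : NonZero c}} .{{_ : NonZero C}} →
                   (C *ℕ c) *ℕ (c *ℕ n ∸ s) ≤ c *ℕ n → c *ℕ n ≤ n / C + s
small-deficiency c C n s bound = begin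
  c *ℕ n          ≤⟨ m≤n+m∸n (c *ℕ n) s ⟩
  s + g           ≤⟨ +-monoʳ-≤ s g≤n/C ⟩
  s + n / C       ≡⟨ +-comm s (n / C) ⟩
  n / C + s       ∎
  where
  open ≤-Reasoning
  g : ℕ
  g = c *ℕ n ∸ s
  Cg≤n : C *ℕ g ≤ n
  Cg≤n = *-cancelˡ-≤ c (begin
    c *ℕ (C *ℕ g)   ≡⟨ *-assoc c C g ⟨
    (c *ℕ C) *ℕ g   ≡⟨ cong (_*ℕ g) (*-comm c C) ⟩
    (C *ℕ c) *ℕ g   ≤⟨ bound ⟩
    c *ℕ n          ∎)
  g≤n/C : g ≤ n / C
  g≤n/C = begin
    g               ≡⟨ m*n/n≡m g C ⟨
    g *ℕ C / C      ≤⟨ /-monoˡ-≤ C (≤-trans (≤-reflexive (*-comm g C)) Cg≤n) ⟩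
    n / C           ∎

numerator-scaling : ∀ (p : ℚ) z d → toℚᵘ p ≃ mkℚᵘ z d →
                    ℤ.∣ ℚ.↥ p ∣ *ℕ suc d ≡ ℤ.∣ z ∣ *ℕ ℚ.denominatorℕ p
numerator-scaling (mkℚ pn pd _) z d (*≡* cross) =
  trans (sym (ℤ.abs-* pn (ℤ.+ suc d))) (trans (cong ℤ.∣_∣ cross) (ℤ.abs-* z (ℤ.+ suc pd)))

scaled-exponent : ∀ a b .(cop : Coprime (suc a) (suc b)) n →
                  let p = mkℚ (ℤ.+ suc a) b cop * toℚ n in
                  ℤ.∣ ℚ.↥ p ∣ *ℕ suc b ≡ (suc a *ℕ n) *ℕ ℚ.denominatorℕ p
scaled-exponent a b cop n = begin
  ℤ.∣ ℚ.↥ p ∣ *ℕ suc b                       ≡⟨ cong (λ x → ℤ.∣ ℚ.↥ p ∣ *ℕ suc x) (*-identityʳ b) ⟨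
  ℤ.∣ ℚ.↥ p ∣ *ℕ suc (b *ℕ 1)                ≡⟨ numerator-scaling p (ℤ.+ suc a ℤ.* ℤ.+ n) (b *ℕ 1) p≃ ⟩
  ℤ.∣ ℤ.+ suc a ℤ.* ℤ.+ n ∣ *ℕ ℚ.denominatorℕ p  ≡⟨ cong (_*ℕ ℚ.denominatorℕ p) (ℤ.abs-* (ℤ.+ suc a) (ℤ.+ n)) ⟩
  (suc a *ℕ n) *ℕ ℚ.denominatorℕ p           ∎
  where
  open ≡-Reasoning
  ε p : ℚ
  ε = mkℚ (ℤ.+ suc a) b cop
  p = ε * toℚ n
  p≃ : toℚᵘ p ≃ mkℚᵘ (ℤ.+ suc a ℤ.* ℤ.+ n) (b *ℕ 1)
  p≃ = ℚᵘ.≃-trans (ℚ.toℚᵘ-homo-* ε (toℚ n))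
         (subst (λ x → (toℚᵘ ε ℚᵘ.* x) ≃ mkℚᵘ (ℤ.+ suc a ℤ.* ℤ.+ n) (b *ℕ 1)) (sym (toℚᵘ-toℚ n)) ℚᵘ.≃-refl)

-- If Y^(2(b+1)) ≤ 4^n, i.e. Y ≤ 2^(n/(b+1)), then Y ≤ q^(εn) for every
-- q ≥ 2 and ε = (a+1)/(b+1) ≥ 1/(b+1).
below-rational-power : ∀ q a b .(cop : Coprime (suc a) (suc b)) n Y → 2 ≤ q →
                       Y ^ (2 *ℕ suc b) ≤ 4 ^ n → Y ≤ q ^ℚ (mkℚ (ℤ.+ suc a) b cop * toℚ n)
below-rational-power q a b cop n Y 2≤q Y^h≤4^n = ^-cancelˡ-≤ h (begin
  (Y ^ d) ^ h                     ≡⟨ ^-swap Y d h ⟩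
  (Y ^ h) ^ d                     ≤⟨ ^-monoˡ-≤ d (≤-trans Y^h≤4^n (^-monoˡ-≤ n 4≤q²)) ⟩
  ((q ^ 2) ^ n) ^ d               ≡⟨ trans (cong (_^ d) (^-*-assoc q 2 n)) (^-*-assoc q (2 *ℕ n) d) ⟩
  q ^ ((2 *ℕ n) *ℕ d)             ≤⟨ ^-monoʳ-≤ q (*-monoˡ-≤ d (*-monoʳ-≤ 2 (m≤m+n n (a *ℕ n)))) ⟩
  q ^ ((2 *ℕ (suc a *ℕ n)) *ℕ d)  ≡⟨ cong (q ^_) exponents ⟩
  q ^ (k *ℕ h)                    ≡⟨ ^-*-assoc q k h ⟨
  (q ^ k) ^ h                     ∎)
  where
  open ≤-Reasoning
  instance
    q≢0 : NonZero q
    q≢0 = >-nonZero (≤-trans (s≤s z≤n) 2≤q)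
  p : ℚ
  p = mkℚ (ℤ.+ suc a) b cop * toℚ n
  h d k : ℕ
  h = 2 *ℕ suc b
  d = ℚ.denominatorℕ p
  k = ℤ.∣ ℚ.↥ p ∣
  4≤q² : 4 ≤ q ^ 2
  4≤q² = *-mono-≤ 2≤q (≤-trans 2≤q (≤-reflexive (sym (*-identityʳ q))))
  double : ∀ x y → 2 *ℕ (x *ℕ y) ≡ x *ℕ (2 *ℕ y)
  double = solve-∀
  exponents : (2 *ℕ (suc a *ℕ n)) *ℕ d ≡ k *ℕ h
  exponents = begin-equality
    (2 *ℕ (suc a *ℕ n)) *ℕ d   ≡⟨ *-assoc 2 (suc a *ℕ n) d ⟩
    2 *ℕ ((suc a *ℕ n) *ℕ d)   ≡⟨ cong (2 *ℕ_) (scaled-exponent a b cop n) ⟨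
    2 *ℕ (k *ℕ suc b)          ≡⟨ double k (suc b) ⟩
    k *ℕ h                     ∎

primePower≥2 : ∀ {q} → IsPrimePower q → 2 ≤ q
primePower≥2 (p , suc k , p-prime , _ , refl) = ≤-trans 2≤p (m≤m*n p (p ^ k) {{m^n≢0 p k {{p≢0}}}})
  where
  2≤p : 2 ≤ p
  2≤p = nonTrivial⇒n>1 p {{prime⇒nonTrivial p-prime}}
  p≢0 : NonZero p
  p≢0 = >-nonZero (≤-trans (s≤s z≤n) 2≤p)

missing-bound : ∀ c C r n .{{_ : NonZero c}} .{{_ : NonZero C}} → suc r ≡ C *ℕ c →
  suc c ^ n ∸ m ((1ℚ - unitFraction r) * toℚ (c *ℕ n)) (suc c) n ≤ nearlyFull c n (n / C)
missing-bound c C r n r+1≡Cc = m≤n+o⇒m∸n≤o (suc c ^ n) low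
  (subst (_≤ low + nearlyFull c n (n / C)) (monomials-count (suc c) n)
    (count-cover (λ v → toℚ (totalDegree v) ℚ.≤? threshold) (λ v → c *ℕ n ≤? n / C + totalDegree v)
                 nearly-full (monomials (suc c) n)))
  where
  threshold : ℚ
  threshold = (1ℚ - unitFraction r) * toℚ (c *ℕ n)
  low : ℕ
  low = m threshold (suc c) n
  nearly-full : ∀ (v : Vec ℕ n) → ¬ (toℚ (totalDegree v) ℚ.≤ threshold) → c *ℕ n ≤ n / C + totalDegree v
  nearly-full v above = small-deficiency c C n (totalDegree v)
    (subst (λ R → R *ℕ (c *ℕ n ∸ totalDegree v) ≤ c *ℕ n) r+1≡Cc (deficiency-bound r (totalDegree v) (c *ℕ n) above))

Conclusion : ℕ → ℚ → Set
Conclusion q ε = Σ ℚ λ δ → Positive δ × Σ ℕ λ N → (n : ℕ) → N ≤ n →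
  (q ^ n ∸ m ((1ℚ - δ) * toℚ ((q ∸ 1) *ℕ n)) q n) ≤ q ^ℚ (ε * toℚ n)

theorem-for : ∀ d a b .(cop : Coprime (suc a) (suc b)) → Conclusion (suc (suc d)) (mkℚ (ℤ.+ suc a) b cop)
theorem-for d a b cop = unitFraction r , _ , 0 , λ n _ → bound n
  where
  c h r : ℕ
  c = suc d
  h = 2 *ℕ suc b
  open Parameters h
  r = pred (C *ℕ c)
  Y X : ℕ → ℕ
  Y n = suc c ^ n ∸ m ((1ℚ - unitFraction r) * toℚ (c *ℕ n)) (suc c) n
  X n = nearlyFull c n (n / C)
  bound : ∀ n → Y n ≤ suc c ^ℚ (mkℚ (ℤ.+ suc a) b cop * toℚ n)
  bound n = below-rational-power (suc c) a b cop n (Y n) (s≤s (s≤s z≤n)) (begin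
    Y n ^ h  ≤⟨ ^-monoˡ-≤ h (missing-bound c C r n refl) ⟩
    X n ^ h  ≤⟨ power-bound n (n / C) (X n) (m/n*n≤m n C) (tail-bound c n (n / C) w) ⟩
    4 ^ n    ∎)
    where open ≤-Reasoning

mainTheorem2 : (q : ℕ) → IsPrimePower q → (ε : ℚ) → Positive ε →
    Σ ℚ λ δ → Positive δ × Σ ℕ λ N → (n : ℕ) → N ≤ n →
      (q ^ n ∸ m ((1ℚ - δ) * toℚ ((q ∸ 1) *ℕ n)) q n) ≤ q ^ℚ (ε * toℚ n)
mainTheorem2 zero          pp _ _ = contradiction (primePower≥2 pp) λ ()
mainTheorem2 (suc zero)    pp _ _ = contradiction (primePower≥2 pp) λ { (s≤s ()) }
mainTheorem2 (suc (suc d)) _ (mkℚ +[1+ a ] b cop) _ = theorem-for d a b cop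
mainTheorem2 (suc (suc d)) _ (mkℚ +0 _ _) ()
mainTheorem2 (suc (suc d)) _ (mkℚ -[1+ _ ] _ _) ()
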